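{- Let $a$, $b$ and $n$ be positive integers with $a>b$. Then $$(2bn+1)(2bn+3)\binom{2bn}{bn} \ \text{ divides } \ 3(a-b)(3a-b)\binom{2an}{an}\binom{an}{bn}.$$ -}

module Defs where

{-# OPTIONS --safe #-}
-- The quotient T(k,j) = C(2(k+j),k+j) C(k+j,k) / C(2k,k) obeys the integer recurrence
-- T(k+1,j+1) = 4 T(k+1,j) + T(k,j+1), so with k = bn, c = a − b, j = cn the claim becomes
-- (2k+1)(2k+3) ∣ 3c(2b+3c) T(k,j). Two steps of j T(k,j) = 2(2k+1) T(k+1,j−1) give
-- j(j−1) T(k,j) = 4(2k+1)(2k+3) T(k+2,j−2). As n is prime to 2k+1 = 2bn+1 and j − 1 is prime
-- to n, both n and j − 1 divide 12(2b+3c) T(k+2,j−2); dividing by n(j−1) leaves the factor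
-- (2k+1)(2k+3) in 3c(2b+3c) T(k,j).
module Submission where

open import Defs
open import Data.Nat using (ℕ; _+_; _*_; _∸_; _<_)
open import Data.Nat.Divisibility using (_∣_)
open import Data.Nat.Combinatorics using (_C_)

open import Data.Nat.Base using (zero; suc; _!; _≤_; NonZero)
open import Data.Nat.Properties
open import Data.Nat.Combinatorics using (nCk≡n!/k![n-k]!; k![n∸k]!∣n!)
open import Data.Nat.Divisibility
  using (divides; ∣1⇒≡1; ∣m+n∣m⇒∣n; ∣m⇒∣m*n; ∣n⇒∣m*n; m∣m*n; *-monoˡ-∣; *-monoʳ-∣; *-cancelʳ-∣)
open import Data.Nat.Coprimality using (Coprime; coprime-divisor) renaming (sym to coprime-sym)
open import Data.Product.Base using (_,_)
open import Relation.Nullary.Negation using (contradiction)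
open import Data.Nat.DivMod using (m/n*n≡m)
open import Relation.Binary.PropositionalEquality
open import Data.Nat.Tactic.RingSolver using (solve-∀)
open ≡-Reasoning

nCk*[k!*[n∸k]!]≡n! : ∀ {n k} → k ≤ n → (n C k) * (k ! * (n ∸ k) !) ≡ n !
nCk*[k!*[n∸k]!]≡n! {n} {k} k≤n =
  trans (cong (_* (k ! * (n ∸ k) !)) (nCk≡n!/k![n-k]! k≤n)) (m/n*n≡m {{k !* (n ∸ k) !≢0}} (k![n∸k]!∣n! k≤n))

D : ℕ → ℕ
D zero    = 1
D (suc k) = 2 * (1 + 2 * k) * D k

D≢0 : ∀ k → NonZero (D k)
D≢0 zero    = _
D≢0 (suc k) = m*n≢0 (2 * (1 + 2 * k)) (D k) {{_}} {{D≢0 k}}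

[2k]!≡Dk*k! : ∀ k → (2 * k) ! ≡ D k * k !
[2k]!≡Dk*k! zero    = refl
[2k]!≡Dk*k! (suc k) = begin
  (2 * suc k) !                             ≡⟨ cong _! (*-suc 2 k) ⟩
  (2 + 2 * k) * ((1 + 2 * k) * (2 * k) !)   ≡⟨ cong (λ x → (2 + 2 * k) * ((1 + 2 * k) * x)) ([2k]!≡Dk*k! k) ⟩
  (2 + 2 * k) * ((1 + 2 * k) * (D k * k !)) ≡⟨ ring k (D k) (k !) ⟩
  D (suc k) * suc k !                       ∎
  where
  ring : ∀ k d f → (2 + 2 * k) * ((1 + 2 * k) * (d * f)) ≡ 2 * (1 + 2 * k) * d * ((1 + k) * f)
  ring = solve-∀

[2k]Ck*k!≡Dk : ∀ k → ((2 * k) C k) * k ! ≡ D k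
[2k]Ck*k!≡Dk k = *-cancelʳ-≡ _ _ (k !) {{k !≢0}} (begin
  ((2 * k) C k) * k ! * k !                  ≡⟨ *-assoc ((2 * k) C k) (k !) (k !) ⟩
  ((2 * k) C k) * (k ! * k !)                ≡⟨ cong (λ m → ((2 * k) C k) * (k ! * m !)) (sym 2k∸k≡k) ⟩
  ((2 * k) C k) * (k ! * (2 * k ∸ k) !)      ≡⟨ nCk*[k!*[n∸k]!]≡n! (m≤m+n k (k + 0)) ⟩
  (2 * k) !                                  ≡⟨ [2k]!≡Dk*k! k ⟩
  D k * k !                                  ∎)
  where
  2k∸k≡k : 2 * k ∸ k ≡ k
  2k∸k≡k = trans (m+n∸m≡n k (k + 0)) (+-identityʳ k)

-- T k j = C(2(k+j), k+j) C(k+j, k) / C(2k, k), which the recurrence shows to be an integer.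
T : ℕ → ℕ → ℕ
T zero    j       = (2 * j) C j
T (suc k) zero    = 1
T (suc k) (suc j) = 4 * T (suc k) j + T k (suc j)

Dk*j!*Tkj≡D[k+j] : ∀ k j → D k * j ! * T k j ≡ D (k + j)
Dk*j!*Tkj≡D[k+j] zero j = begin
  1 * j ! * ((2 * j) C j) ≡⟨ cong (_* ((2 * j) C j)) (*-identityˡ (j !)) ⟩
  j ! * ((2 * j) C j)     ≡⟨ *-comm (j !) ((2 * j) C j) ⟩
  ((2 * j) C j) * j !     ≡⟨ [2k]Ck*k!≡Dk j ⟩
  D j                     ∎
Dk*j!*Tkj≡D[k+j] (suc k) zero = begin
  D (suc k) * 1 * 1 ≡⟨ *-identityʳ (D (suc k) * 1) ⟩
  D (suc k) * 1     ≡⟨ *-identityʳ (D (suc k)) ⟩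
  D (suc k)         ≡⟨ cong (λ m → D (suc m)) (+-identityʳ k) ⟨
  D (suc k + 0)     ∎
Dk*j!*Tkj≡D[k+j] (suc k) (suc j) = begin
  D (suc k) * suc j ! * (4 * T (suc k) j + T k (suc j))
    ≡⟨ expand k j (D k) (j !) (T (suc k) j) (T k (suc j)) ⟩
  4 * suc j * (D (suc k) * j ! * T (suc k) j) + 2 * (1 + 2 * k) * (D k * suc j ! * T k (suc j))
    ≡⟨ cong₂ (λ x y → 4 * suc j * x + 2 * (1 + 2 * k) * y) (Dk*j!*Tkj≡D[k+j] (suc k) j) (Dk*j!*Tkj≡D[k+j] k (suc j)) ⟩
  4 * suc j * D (suc (k + j)) + 2 * (1 + 2 * k) * D (k + suc j)
    ≡⟨ cong (λ m → 4 * suc j * D (suc (k + j)) + 2 * (1 + 2 * k) * D m) (+-suc k j) ⟩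
  4 * suc j * D (suc (k + j)) + 2 * (1 + 2 * k) * D (suc (k + j))
    ≡⟨ collect k j (D (suc (k + j))) ⟩
  D (suc (suc (k + j)))
    ≡⟨ cong (λ m → D (suc m)) (sym (+-suc k j)) ⟩
  D (suc k + suc j) ∎
  where
  expand : ∀ k j d f t₁ t₂ →
    2 * (1 + 2 * k) * d * ((1 + j) * f) * (4 * t₁ + t₂)
      ≡ 4 * (1 + j) * (2 * (1 + 2 * k) * d * f * t₁) + 2 * (1 + 2 * k) * (d * ((1 + j) * f) * t₂)
  expand = solve-∀
  collect : ∀ k j x → 4 * (1 + j) * x + 2 * (1 + 2 * k) * x ≡ 2 * (1 + 2 * (1 + (k + j))) * x
  collect = solve-∀

T-shift : ∀ k j → (1 + j) * T k (1 + j) ≡ 2 * (1 + 2 * k) * T (1 + k) j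
T-shift k j = *-cancelʳ-≡ _ _ (D k * j !) {{m*n≢0 (D k) (j !) {{D≢0 k}} {{j !≢0}}}} (begin
  (1 + j) * T k (1 + j) * (D k * j !)         ≡⟨ shuffle j (D k) (j !) (T k (1 + j)) ⟩
  D k * suc j ! * T k (1 + j)                 ≡⟨ Dk*j!*Tkj≡D[k+j] k (suc j) ⟩
  D (k + suc j)                               ≡⟨ cong D (+-suc k j) ⟩
  D (suc k + j)                               ≡⟨ Dk*j!*Tkj≡D[k+j] (suc k) j ⟨
  D (suc k) * j ! * T (suc k) j               ≡⟨ unfold k (D k) (j !) (T (suc k) j) ⟩
  2 * (1 + 2 * k) * T (1 + k) j * (D k * j !) ∎)
  where
  shuffle : ∀ j d f t → (1 + j) * t * (d * f) ≡ d * ((1 + j) * f) * t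
  shuffle = solve-∀
  unfold : ∀ k d f t → 2 * (1 + 2 * k) * d * f * t ≡ 2 * (1 + 2 * k) * t * (d * f)
  unfold = solve-∀

T-shift² : ∀ k i → (1 + i) * (2 + i) * T k (2 + i) ≡ 4 * (1 + 2 * k) * (3 + 2 * k) * T (2 + k) i
T-shift² k i = begin
  (1 + i) * (2 + i) * T k (2 + i)                 ≡⟨ *-assoc (1 + i) (2 + i) (T k (2 + i)) ⟩
  (1 + i) * ((2 + i) * T k (2 + i))               ≡⟨ cong ((1 + i) *_) (T-shift k (1 + i)) ⟩
  (1 + i) * (2 * (1 + 2 * k) * T (1 + k) (1 + i)) ≡⟨ swap (1 + i) (2 * (1 + 2 * k)) (T (1 + k) (1 + i)) ⟩
  2 * (1 + 2 * k) * ((1 + i) * T (1 + k) (1 + i)) ≡⟨ cong (2 * (1 + 2 * k) *_) (T-shift (1 + k) i) ⟩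
  2 * (1 + 2 * k) * (2 * (1 + 2 * (1 + k)) * T (2 + k) i) ≡⟨ collect k (T (2 + k) i) ⟩
  4 * (1 + 2 * k) * (3 + 2 * k) * T (2 + k) i     ∎
  where
  swap : ∀ x y z → x * (y * z) ≡ y * (x * z)
  swap = solve-∀
  collect : ∀ k t → 2 * (1 + 2 * k) * (2 * (1 + 2 * (1 + k)) * t) ≡ 4 * (1 + 2 * k) * (3 + 2 * k) * t
  collect = solve-∀

T-binomial : ∀ k j → ((2 * k) C k) * T k j ≡ ((2 * (k + j)) C (k + j)) * ((k + j) C k)
T-binomial k j = *-cancelʳ-≡ _ _ (k ! * j !) {{k !* j !≢0}} (begin
  ((2 * k) C k) * T k j * (k ! * j !)     ≡⟨ regroup ((2 * k) C k) (T k j) (k !) (j !) ⟩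
  ((2 * k) C k) * k ! * j ! * T k j       ≡⟨ cong (λ x → x * j ! * T k j) ([2k]Ck*k!≡Dk k) ⟩
  D k * j ! * T k j                       ≡⟨ Dk*j!*Tkj≡D[k+j] k j ⟩
  D (k + j)                               ≡⟨ [2k]Ck*k!≡Dk (k + j) ⟨
  ((2 * (k + j)) C (k + j)) * (k + j) !   ≡⟨ cong (((2 * (k + j)) C (k + j)) *_) (nCk*[k!*[n∸k]!]≡n! (m≤m+n k j)) ⟨
  ((2 * (k + j)) C (k + j)) * (((k + j) C k) * (k ! * (k + j ∸ k) !))
                                          ≡⟨ cong (λ m → ((2 * (k + j)) C (k + j)) * (((k + j) C k) * (k ! * m !))) (m+n∸m≡n k j) ⟩
  ((2 * (k + j)) C (k + j)) * (((k + j) C k) * (k ! * j !))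
                                          ≡⟨ *-assoc ((2 * (k + j)) C (k + j)) ((k + j) C k) (k ! * j !) ⟨
  ((2 * (k + j)) C (k + j)) * ((k + j) C k) * (k ! * j !) ∎)
  where
  regroup : ∀ c t f g → c * t * (f * g) ≡ c * f * g * t
  regroup = solve-∀

m*x≡1+n*y⇒coprime : ∀ {m n x y} → m * x ≡ 1 + n * y → Coprime m n
m*x≡1+n*y⇒coprime {m} {n} {x} {y} eq {d} (d∣m , d∣n) = ∣1⇒≡1 (∣m+n∣m⇒∣n d∣n*y+1 (∣m⇒∣m*n y d∣n))
  where
  d∣n*y+1 : d ∣ n * y + 1
  d∣n*y+1 = subst (d ∣_) (trans eq (+-comm 1 (n * y))) (∣m⇒∣m*n x d∣m)

coprime⇒m*n∣x : ∀ {m n x} → Coprime m n → m ∣ x → n ∣ x → m * n ∣ x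
coprime⇒m*n∣x {m} {n} {x} coprime m∣x (divides q x≡q*n) = subst (m * n ∣_) (sym x≡q*n) (*-monoˡ-∣ n m∣q)
  where
  m∣q : m ∣ q
  m∣q = coprime-divisor coprime (subst (m ∣_) (trans x≡q*n (*-comm q n)) m∣x)

T-divisible-1 : ∀ b → (2 * (b * 1) + 1) * (2 * (b * 1) + 3) ∣ 3 * 1 * (2 * b + 3 * 1) * T (b * 1) 1
T-divisible-1 b = divides 6 (begin
  3 * 1 * (2 * b + 3 * 1) * T (b * 1) 1           ≡⟨ cong (3 * 1 * (2 * b + 3 * 1) *_) T[k,1] ⟩
  3 * 1 * (2 * b + 3 * 1) * (2 * (1 + 2 * (b * 1))) ≡⟨ ring b ⟩
  6 * ((2 * (b * 1) + 1) * (2 * (b * 1) + 3))      ∎)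
  where
  T[k,1] : T (b * 1) 1 ≡ 2 * (1 + 2 * (b * 1))
  T[k,1] = trans (sym (*-identityˡ _)) (trans (T-shift (b * 1) 0) (*-identityʳ _))
  ring : ∀ b → 3 * 1 * (2 * b + 3 * 1) * (2 * (1 + 2 * (b * 1))) ≡ 6 * ((2 * (b * 1) + 1) * (2 * (b * 1) + 3))
  ring = solve-∀

T-divisible-≥2 : ∀ b c n i → c * n ≡ 2 + i →
  (2 * (b * n) + 1) * (2 * (b * n) + 3) ∣ 3 * c * (2 * b + 3 * c) * T (b * n) (2 + i)
T-divisible-≥2 b c n i cn≡2+i =
  *-cancelʳ-∣ (n * (1 + i)) {{n*[1+i]≢0}}
    (subst ((2 * k + 1) * (2 * k + 3) * (n * (1 + i)) ∣_) cleared (*-monoʳ-∣ ((2 * k + 1) * (2 * k + 3)) n[1+i]∣E))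
  where
  k T₀ T₁ T₂ E : ℕ
  k  = b * n
  T₀ = T k (2 + i)
  T₁ = T (1 + k) (1 + i)
  T₂ = T (2 + k) i
  E  = (2 * b + 3 * c) * (12 * T₂)

  n*[1+i]≢0 : NonZero (n * (1 + i))
  n*[1+i]≢0 = m*n≢0 n (1 + i) {{m*n≢0⇒n≢0 c {n} {{cn≢0}}}}
    where
    cn≢0 : NonZero (c * n)
    cn≢0 = subst NonZero (sym cn≡2+i) _

  n⊥1+2k : Coprime n (1 + 2 * k)
  n⊥1+2k = coprime-sym (m*x≡1+n*y⇒coprime (ring b n))
    where
    ring : ∀ b n → (1 + 2 * (b * n)) * 1 ≡ 1 + n * (2 * b)
    ring = solve-∀

  n⊥1+i : Coprime n (1 + i)
  n⊥1+i = m*x≡1+n*y⇒coprime (trans (*-comm n c) (trans cn≡2+i (cong suc (sym (*-identityʳ (1 + i))))))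

  n∣E : n ∣ E
  n∣E = ∣n⇒∣m*n (2 * b + 3 * c) (∣m+n∣m⇒∣n (subst (n ∣_) (split b n T₂) n∣4[3+2k]T₂) (m∣m*n (8 * b * T₂)))
    where
    n∣4[3+2k]T₂ : n ∣ 4 * (3 + 2 * k) * T₂
    n∣4[3+2k]T₂ = coprime-divisor n⊥1+2k (divides ((1 + i) * c * T₀) (begin
      (1 + 2 * k) * (4 * (3 + 2 * k) * T₂) ≡⟨ regroup k T₂ ⟩
      4 * (1 + 2 * k) * (3 + 2 * k) * T₂   ≡⟨ T-shift² k i ⟨
      (1 + i) * (2 + i) * T₀               ≡⟨ cong (λ x → (1 + i) * x * T₀) cn≡2+i ⟨
      (1 + i) * (c * n) * T₀               ≡⟨ swap (1 + i) c n T₀ ⟩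
      (1 + i) * c * T₀ * n                 ∎))
      where
      regroup : ∀ k t → (1 + 2 * k) * (4 * (3 + 2 * k) * t) ≡ 4 * (1 + 2 * k) * (3 + 2 * k) * t
      regroup = solve-∀
      swap : ∀ x c n t → x * (c * n) * t ≡ x * c * t * n
      swap = solve-∀
    split : ∀ b n t → 4 * (3 + 2 * (b * n)) * t ≡ n * (8 * b * t) + 12 * t
    split = solve-∀

  1+i∣E : 1 + i ∣ E
  1+i∣E = coprime-divisor (coprime-sym n⊥1+i) (divides (6 * T₁ + 36 * T₂) (begin
    n * E                                        ≡⟨ expand b c n T₂ ⟩
    12 * T₂ * (2 * k + 3 * (c * n))              ≡⟨ cong (λ x → 12 * T₂ * (2 * k + 3 * x)) cn≡2+i ⟩
    12 * T₂ * (2 * k + 3 * (2 + i))              ≡⟨ regroup k i T₂ ⟩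
    6 * (2 * (1 + 2 * (1 + k)) * T₂) + 36 * T₂ * (1 + i) ≡⟨ cong (λ x → 6 * x + 36 * T₂ * (1 + i)) (T-shift (1 + k) i) ⟨
    6 * ((1 + i) * T₁) + 36 * T₂ * (1 + i)       ≡⟨ collect i T₁ T₂ ⟩
    (6 * T₁ + 36 * T₂) * (1 + i)                 ∎))
    where
    expand : ∀ b c n t → n * ((2 * b + 3 * c) * (12 * t)) ≡ 12 * t * (2 * (b * n) + 3 * (c * n))
    expand = solve-∀
    regroup : ∀ k i t → 12 * t * (2 * k + 3 * (2 + i)) ≡ 6 * (2 * (1 + 2 * (1 + k)) * t) + 36 * t * (1 + i)
    regroup = solve-∀
    collect : ∀ i t₁ t₂ → 6 * ((1 + i) * t₁) + 36 * t₂ * (1 + i) ≡ (6 * t₁ + 36 * t₂) * (1 + i)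
    collect = solve-∀

  n[1+i]∣E : n * (1 + i) ∣ E
  n[1+i]∣E = coprime⇒m*n∣x n⊥1+i n∣E 1+i∣E

  cleared : (2 * k + 1) * (2 * k + 3) * E ≡ 3 * c * (2 * b + 3 * c) * T₀ * (n * (1 + i))
  cleared = begin
    (2 * k + 1) * (2 * k + 3) * E                          ≡⟨ regroup k (2 * b + 3 * c) T₂ ⟩
    3 * (2 * b + 3 * c) * (4 * (1 + 2 * k) * (3 + 2 * k) * T₂) ≡⟨ cong (3 * (2 * b + 3 * c) *_) (T-shift² k i) ⟨
    3 * (2 * b + 3 * c) * ((1 + i) * (2 + i) * T₀)         ≡⟨ cong (λ x → 3 * (2 * b + 3 * c) * ((1 + i) * x * T₀)) cn≡2+i ⟨
    3 * (2 * b + 3 * c) * ((1 + i) * (c * n) * T₀)         ≡⟨ collect (2 * b + 3 * c) c n i T₀ ⟩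
    3 * c * (2 * b + 3 * c) * T₀ * (n * (1 + i))           ∎
    where
    regroup : ∀ k d t → (2 * k + 1) * (2 * k + 3) * (d * (12 * t)) ≡ 3 * d * (4 * (1 + 2 * k) * (3 + 2 * k) * t)
    regroup = solve-∀
    collect : ∀ d c n i t → 3 * d * ((1 + i) * (c * n) * t) ≡ 3 * c * d * t * (n * (1 + i))
    collect = solve-∀

T-divisible : ∀ b c n → 0 < c → 0 < n →
  (2 * (b * n) + 1) * (2 * (b * n) + 3) ∣ 3 * c * (2 * b + 3 * c) * T (b * n) (c * n)
T-divisible b c n 0<c 0<n with c * n in cn≡
... | zero        = contradiction (sym cn≡) (<⇒≢ (*-mono-< 0<c 0<n))
... | suc zero    rewrite m*n≡1⇒m≡1 c n cn≡ | m*n≡1⇒n≡1 c n cn≡ = T-divisible-1 b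
... | suc (suc i) = T-divisible-≥2 b c n i cn≡

T-divisible⇒binomials-divisible : ∀ k j x → (2 * k + 1) * (2 * k + 3) ∣ x * T k j →
  (2 * k + 1) * (2 * k + 3) * ((2 * k) C k) ∣ x * ((2 * (k + j)) C (k + j)) * ((k + j) C k)
T-divisible⇒binomials-divisible k j x d∣xT =
  subst ((2 * k + 1) * (2 * k + 3) * ((2 * k) C k) ∣_) xT≡ (*-monoˡ-∣ ((2 * k) C k) d∣xT)
  where
  xT≡ : x * T k j * ((2 * k) C k) ≡ x * ((2 * (k + j)) C (k + j)) * ((k + j) C k)
  xT≡ = begin
    x * T k j * ((2 * k) C k)                         ≡⟨ *-assoc x (T k j) ((2 * k) C k) ⟩
    x * (T k j * ((2 * k) C k))                       ≡⟨ cong (x *_) (*-comm (T k j) ((2 * k) C k)) ⟩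
    x * (((2 * k) C k) * T k j)                       ≡⟨ cong (x *_) (T-binomial k j) ⟩
    x * (((2 * (k + j)) C (k + j)) * ((k + j) C k))   ≡⟨ *-assoc x _ _ ⟨
    x * ((2 * (k + j)) C (k + j)) * ((k + j) C k)     ∎

3a∸b≡2b+3[a∸b] : ∀ {a b} → b ≤ a → 3 * a ∸ b ≡ 2 * b + 3 * (a ∸ b)
3a∸b≡2b+3[a∸b] {a} {b} b≤a = begin
  3 * a ∸ b                         ≡⟨ cong (λ x → 3 * x ∸ b) (m+[n∸m]≡n b≤a) ⟨
  3 * (b + (a ∸ b)) ∸ b             ≡⟨ cong (_∸ b) (ring b (a ∸ b)) ⟩
  2 * b + 3 * (a ∸ b) + b ∸ b       ≡⟨ m+n∸n≡m (2 * b + 3 * (a ∸ b)) b ⟩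
  2 * b + 3 * (a ∸ b)               ∎
  where
  ring : ∀ b c → 3 * (b + c) ≡ 2 * b + 3 * c + b
  ring = solve-∀

a*n≡b*n+[a∸b]*n : ∀ {a b} n → b ≤ a → a * n ≡ b * n + (a ∸ b) * n
a*n≡b*n+[a∸b]*n {a} {b} n b≤a = trans (cong (_* n) (sym (m+[n∸m]≡n b≤a))) (*-distribʳ-+ n b (a ∸ b))

theorem1 : (a b n : ℕ) → 0 < a → 0 < b → 0 < n → b < a →
    ((2 * b * n + 1) * (2 * b * n + 3) * ((2 * b * n) C (b * n)))
      ∣ (3 * (a ∸ b) * (3 * a ∸ b) * ((2 * a * n) C (a * n)) * ((a * n) C (b * n)))
theorem1 a b n _ _ 0<n b<a
  rewrite *-assoc 2 b n | *-assoc 2 a n | a*n≡b*n+[a∸b]*n n (<⇒≤ b<a) | 3a∸b≡2b+3[a∸b] (<⇒≤ b<a) =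
  T-divisible⇒binomials-divisible (b * n) ((a ∸ b) * n) (3 * (a ∸ b) * (2 * b + 3 * (a ∸ b)))
    (T-divisible b (a ∸ b) n (m<n⇒0<n∸m b<a) 0<n)
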